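{- Let $n$ be a positive integer and $\sigma=(r_1,\dots,r_k)$ a composition of $n$, with partial sums $s_i=r_1+\cdots+r_i$ for $i\in[k]$. Let $h_i(\sigma)$ be the number of points $(a_1,\dots,a_n)\in\mathbb{N}^n$ with $a_1+\cdots+a_{s_i}\le s_i$ for all $i\in[k]$ which have exactly $i$ nonzero coordinates, and let $h(\sigma,t)=\sum_{i=0}^n h_i(\sigma)t^i$. Then $h(\sigma,t)$ is $\gamma$-positive, i.e. there exist nonnegative integers $\gamma_i(\sigma)$, $0\le i\le\lfloor n/2\rfloor$, such that \[ h(\sigma,t)=\sum_{i=0}^{\lfloor n/2\rfloor}\gamma_i(\sigma)\,t^i(1+t)^{n-2i}. \] In particular, the vector $(h_0(\sigma),\dots,h_n(\sigma))$ is palindromic ($h_i(\sigma)=h_{n-i}(\sigma)$ for all $i$) and unimodal ($h_0(\sigma)\le h_1(\sigma)\le\cdots\le h_{\lfloor n/2\rfloor}(\sigma)$).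
   Context: $\mathbb{N}=\{0,1,2,\dots\}$, $[n]=\{1,\dots,n\}$. A composition of $n$ is a sequence of positive integers summing to $n$. The composition polytope $Q_\sigma\subset\mathbb{R}^n$ is defined by $x_j\ge0$ for $j\in[n]$ and $x_1+\cdots+x_{s_i}\le s_i$ for $i\in[k]$; $h_i(\sigma)$ counts its lattice points with exactly $i$ nonzero coordinates. -}

module Defs where

open import Data.Nat using (ℕ; zero; suc; _+_; _*_; _∸_; _≤_; _<_; _≟_; _≤?_; ⌊_/2⌋)
open import Data.Nat.Properties using ()
open import Data.Nat.ListAction using (sum)
open import Data.List using (List; []; _∷_; [_]; map; concatMap; length; filter; take; upTo; replicate; _++_)
open import Data.List.Relation.Unary.All using (All; all?)
open import Data.Vec using (Vec; toList) renaming ([] to []ᵥ; _∷_ to _∷ᵥ_)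
open import Relation.Nullary using (¬?; Dec)
open import Data.Product using (_×_)
open import Relation.Binary.PropositionalEquality using (_≡_)

IsComposition : ℕ → List ℕ → Set
IsComposition n σ = All (λ r → 0 < r) σ × sum σ ≡ n

partialSumsFrom : ℕ → List ℕ → List ℕ
partialSumsFrom acc [] = []
partialSumsFrom acc (r ∷ rs) = (acc + r) ∷ partialSumsFrom (acc + r) rs

partialSums : List ℕ → List ℕ
partialSums = partialSumsFrom 0

InQ : {n : ℕ} → List ℕ → Vec ℕ n → Set
InQ σ a = All (λ s → sum (take s (toList a)) ≤ s) (partialSums σ)

inQ? : {n : ℕ} (σ : List ℕ) (a : Vec ℕ n) → Dec (InQ σ a)
inQ? σ a = all? (λ s → sum (take s (toList a)) ≤? s) (partialSums σ)

boxVecs : (n b : ℕ) → List (Vec ℕ n)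
boxVecs zero b = [ []ᵥ ]
boxVecs (suc n) b = concatMap (λ x → map (x ∷ᵥ_) (boxVecs n b)) (upTo (suc b))

nonzeros : {n : ℕ} → Vec ℕ n → ℕ
nonzeros a = length (filter (λ x → ¬? (x ≟ 0)) (toList a))

-- The lattice points of Q_σ ⊂ ℕⁿ.  For a composition σ of n we have
-- s_k = n, so every such point has all entries ≤ n; hence enumerating
-- the box [0,n]ⁿ and filtering is exact.
latticePoints : (n : ℕ) → List ℕ → List (Vec ℕ n)
latticePoints n σ = filter (inQ? σ) (boxVecs n n)

hcoeff : (n : ℕ) → List ℕ → ℕ → ℕ
hcoeff n σ i = length (filter (λ a → nonzeros a ≟ i) (latticePoints n σ))

-- Polynomials in t with ℕ coefficients, as coefficient lists
-- (constant term first).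

Poly : Set
Poly = List ℕ

coeff : Poly → ℕ → ℕ
coeff [] i = 0
coeff (c ∷ p) zero = c
coeff (c ∷ p) (suc i) = coeff p i

infixl 6 _+ₚ_
infixl 7 _*ₚ_ _·ₚ_

_+ₚ_ : Poly → Poly → Poly
[] +ₚ q = q
(c ∷ p) +ₚ [] = c ∷ p
(c ∷ p) +ₚ (d ∷ q) = (c + d) ∷ (p +ₚ q)

_·ₚ_ : ℕ → Poly → Poly
c ·ₚ p = map (c *_) p

_*ₚ_ : Poly → Poly → Poly
[] *ₚ q = []
(c ∷ p) *ₚ q = (c ·ₚ q) +ₚ (0 ∷ (p *ₚ q))

oneₚ : Poly
oneₚ = [ 1 ]

tPow : ℕ → Poly
tPow j = replicate j 0 ++ [ 1 ]

_^ₚ_ : Poly → ℕ → Poly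
p ^ₚ zero = oneₚ
p ^ₚ suc m = p *ₚ (p ^ₚ m)

onePlusT : Poly
onePlusT = 1 ∷ 1 ∷ []

sumₚ : List Poly → Poly
sumₚ [] = []
sumₚ (p ∷ ps) = p +ₚ sumₚ ps

hPoly : (n : ℕ) → List ℕ → Poly
hPoly n σ = sumₚ (map (λ i → hcoeff n σ i ·ₚ tPow i) (upTo (suc n)))

gammaExpansion : (n : ℕ) → (ℕ → ℕ) → Poly
gammaExpansion n γ =
  sumₚ (map (λ i → γ i ·ₚ (tPow i *ₚ (onePlusT ^ₚ (n ∸ 2 * i))))
            (upTo (suc ⌊ n /2⌋)))

module Submission where

-- Fill in the coordinates from left to right. If r coordinates of the current block remain and
-- the prefix sums may still grow by b, the polynomial L_r(b) counting the completions by their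
-- number of nonzero entries satisfies L_{r+1}(b) = L_r(b) + t Σ_{y<b} L_r(y), and entering a
-- block of size r′ adds r′ to b. Write b ↦ L(b) in the Newton basis b ↦ C(b,k): summation
-- becomes X_k ↦ X_k + t X_{k-1} and the shift b ↦ b + 1 becomes X_k ↦ X_k + X_{k+1}, so a block
-- of size r acts as W^r followed by an index shift by r, where
--   (W X)_j = X_j + (1+t) X_{j-1} + t X_{j-2}.
-- W preserves "X_j is a nonnegative combination of t^u (1+t)^{c+j-2u}", so every Newton
-- coordinate, in particular X_0 = h(σ,t), is γ-positive. Each t^u (1+t)^{n-2u} is palindromic
-- and unimodal about n/2, hence so is h.

open import Defs
open import Data.Nat using (ℕ; _≤_; _<_; _∸_; ⌊_/2⌋)
open import Data.List using (List)
open import Data.Product using (_×_; ∃)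
open import Relation.Binary.PropositionalEquality using (_≡_)

open import Data.Bool using (true; false; if_then_else_)
open import Data.Empty using (⊥-elim)
open import Data.List using ([]; _∷_; _++_; map; filter; concatMap; applyUpTo; upTo; length; take)
open import Data.List.Properties using (map-++; map-cong; map-∘)
open import Data.List.Relation.Unary.All using (all?)
open import Data.Nat using (zero; suc; _+_; _*_; ⌈_/2⌉; z≤n; s≤s; _≤?_; _≟_)
open import Data.Nat.Combinatorics
  using (_C_; k>n⇒nCk≡0; nCk+nC[k+1]≡[n+1]C[k+1]; nCk≡nC[n∸k]; nC1≡n)
open import Data.Nat.ListAction using (sum; product)
open import Data.Nat.ListAction.Properties using (sum-++)
open import Data.Nat.Properties
open import Algebra.Properties.CommutativeSemigroup +-commutativeSemigroup
  using (interchange; xy∙z≈xz∙y; x∙yz≈xz∙y)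
open import Data.Nat.Tactic.RingSolver using (solve-∀)
open import Data.Product using (_,_)
open import Data.Sum using (inj₁; inj₂)
open import Data.Vec using (Vec; toList) renaming (_∷_ to _∷ᵥ_)
open import Function using (_∘_; id)
open import Relation.Binary.PropositionalEquality
  using (refl; sym; trans; cong; cong₂; subst; subst₂; _≗_; module ≡-Reasoning)
open import Relation.Nullary using (Dec; does; yes; no; ¬_)
open import Relation.Unary using (Decidable)

private
  variable
    m n : ℕ

-- Finite sums

∑< : ℕ → (ℕ → ℕ) → ℕ
∑< zero    f = 0
∑< (suc n) f = f 0 + ∑< n (f ∘ suc)

syntax ∑< n (λ x → e) = ∑[ x < n ] e

∑-cong : ∀ n {f g : ℕ → ℕ} → f ≗ g → ∑< n f ≡ ∑< n g
∑-cong zero    f≗g = refl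
∑-cong (suc n) f≗g = cong₂ _+_ (f≗g 0) (∑-cong n (f≗g ∘ suc))

∑-cong-< : ∀ n {f g : ℕ → ℕ} → (∀ x → x < n → f x ≡ g x) → ∑< n f ≡ ∑< n g
∑-cong-< zero    f≗g = refl
∑-cong-< (suc n) f≗g =
  cong₂ _+_ (f≗g 0 (s≤s z≤n)) (∑-cong-< n λ x x<n → f≗g (suc x) (s≤s x<n))

∑-zero : ∀ n {f : ℕ → ℕ} → (∀ x → f x ≡ 0) → ∑< n f ≡ 0
∑-zero zero    f≗0 = refl
∑-zero (suc n) f≗0 = cong₂ _+_ (f≗0 0) (∑-zero n (f≗0 ∘ suc))

∑-distrib-+ : ∀ n (f g : ℕ → ℕ) → ∑[ x < n ] (f x + g x) ≡ ∑< n f + ∑< n g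
∑-distrib-+ zero    f g = refl
∑-distrib-+ (suc n) f g = begin
  (f 0 + g 0) + ∑[ x < n ] (f (suc x) + g (suc x))
    ≡⟨ cong ((f 0 + g 0) +_) (∑-distrib-+ n (f ∘ suc) (g ∘ suc)) ⟩
  (f 0 + g 0) + (∑< n (f ∘ suc) + ∑< n (g ∘ suc))
    ≡⟨ interchange (f 0) (g 0) _ _ ⟩
  (f 0 + ∑< n (f ∘ suc)) + (g 0 + ∑< n (g ∘ suc)) ∎
  where open ≡-Reasoning

∑-snoc : ∀ n (f : ℕ → ℕ) → ∑< (suc n) f ≡ ∑< n f + f n
∑-snoc zero    f = +-comm (f 0) 0
∑-snoc (suc n) f = trans (cong (f 0 +_) (∑-snoc n (f ∘ suc))) (sym (+-assoc (f 0) _ _))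

∑-reverse : ∀ n (f : ℕ → ℕ) → ∑[ x < n ] f (n ∸ suc x) ≡ ∑< n f
∑-reverse zero    f = refl
∑-reverse (suc n) f = begin
  f n + ∑[ x < n ] f (n ∸ suc x) ≡⟨ cong (f n +_) (∑-reverse n f) ⟩
  f n + ∑< n f                   ≡⟨ +-comm (f n) _ ⟩
  ∑< n f + f n                   ≡⟨ ∑-snoc n f ⟨
  ∑< (suc n) f                   ∎
  where open ≡-Reasoning

∑-extend : ∀ {m} n (f : ℕ → ℕ) → m ≤ n → (∀ x → m ≤ x → f x ≡ 0) →
           ∑< n f ≡ ∑< m f
∑-extend zero    f z≤n f≗0 = refl
∑-extend (suc n) f m≤1+n f≗0 with m≤n⇒m<n∨m≡n m≤1+n
... | inj₂ refl      = refl
... | inj₁ (s≤s m≤n) = begin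
  ∑< (suc n) f  ≡⟨ ∑-snoc n f ⟩
  ∑< n f + f n  ≡⟨ cong₂ _+_ (∑-extend n f m≤n f≗0) (f≗0 n m≤n) ⟩
  _ + 0         ≡⟨ +-identityʳ _ ⟩
  _             ∎
  where open ≡-Reasoning

δ : ℕ → ℕ → ℕ
δ zero    zero    = 1
δ zero    (suc j) = 0
δ (suc i) zero    = 0
δ (suc i) (suc j) = δ i j

∑-δ : ∀ n (f : ℕ → ℕ) j → j < n → ∑[ x < n ] (δ x j * f x) ≡ f j
∑-δ (suc n) f zero    _         =
  trans (cong₂ _+_ (*-identityˡ (f 0)) (∑-zero n λ _ → refl)) (+-identityʳ (f 0))
∑-δ (suc n) f (suc j) (s≤s j<n) = ∑-δ n (f ∘ suc) j j<n

∑-δ-beyond : ∀ n (f : ℕ → ℕ) j → n ≤ j → ∑[ x < n ] (δ x j * f x) ≡ 0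
∑-δ-beyond zero    f j       _         = refl
∑-δ-beyond (suc n) f (suc j) (s≤s n≤j) = ∑-δ-beyond n (f ∘ suc) j n≤j

m≤⌊n/2⌋⇒2*m≤n : ∀ {m} n → m ≤ ⌊ n /2⌋ → 2 * m ≤ n
m≤⌊n/2⌋⇒2*m≤n {m} n m≤n/2 = begin
  2 * m                    ≤⟨ *-monoʳ-≤ 2 m≤n/2 ⟩
  ⌊ n /2⌋ + (⌊ n /2⌋ + 0)  ≡⟨ cong (⌊ n /2⌋ +_) (+-identityʳ _) ⟩
  ⌊ n /2⌋ + ⌊ n /2⌋        ≤⟨ +-monoʳ-≤ ⌊ n /2⌋ (⌊n/2⌋≤⌈n/2⌉ n) ⟩
  ⌊ n /2⌋ + ⌈ n /2⌉        ≡⟨ ⌊n/2⌋+⌈n/2⌉≡n n ⟩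
  n                        ∎
  where open ≤-Reasoning

2*m≤n⇒m≤⌊n/2⌋ : ∀ m {n} → 2 * m ≤ n → m ≤ ⌊ n /2⌋
2*m≤n⇒m≤⌊n/2⌋ m {n} 2m≤n = subst (_≤ ⌊ n /2⌋) (sym (n≡⌊n+n/2⌋ m))
  (⌊n/2⌋-mono (subst (_≤ n) (cong (m +_) (+-identityʳ m)) 2m≤n))

-- Power series with natural coefficients

Series : Set
Series = ℕ → ℕ

𝟘 : Series
𝟘 _ = 0

infixl 6 _⊕_
infixr 7 t*_ [1+t]*_ t^_*_

_⊕_ : Series → Series → Series
(p ⊕ q) i = p i + q i

t*_ : Series → Series
(t* p) zero    = 0
(t* p) (suc i) = p i

[1+t]*_ : Series → Series
[1+t]* p = p ⊕ t* p

t^_*_ : ℕ → Series → Series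
t^ zero  * p = p
t^ suc u * p = t* t^ u * p

binomial : ℕ → Series
binomial m i = m C i

𝟙 : Series
𝟙 = δ 0

binomial-zero : binomial 0 ≗ 𝟙
binomial-zero zero    = refl
binomial-zero (suc i) = k>n⇒nCk≡0 {0} {suc i} (s≤s z≤n)

∑ˢ : ℕ → (ℕ → Series) → Series
∑ˢ n F i = ∑[ x < n ] F x i

syntax ∑ˢ n (λ x → e) = ∑ˢ[ x < n ] e

private
  variable
    p q : Series

t*-cong : p ≗ q → t* p ≗ t* q
t*-cong p≗q zero    = refl
t*-cong p≗q (suc i) = p≗q i

t*-𝟘 : 𝟘 ≗ t* 𝟘
t*-𝟘 zero    = refl
t*-𝟘 (suc i) = refl

t*-⊕ : ∀ p q → t* (p ⊕ q) ≗ t* p ⊕ t* q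
t*-⊕ p q zero    = refl
t*-⊕ p q (suc i) = refl

[1+t]*-cong : p ≗ q → [1+t]* p ≗ [1+t]* q
[1+t]*-cong p≗q i = cong₂ _+_ (p≗q i) (t*-cong p≗q i)

[1+t]*-⊕ : ∀ p q → [1+t]* (p ⊕ q) ≗ [1+t]* p ⊕ [1+t]* q
[1+t]*-⊕ p q i = trans (cong ((p i + q i) +_) (t*-⊕ p q i)) (interchange (p i) (q i) _ _)

binomial-sym : ∀ i j → binomial (i + j) i ≡ binomial (i + j) j
binomial-sym i j = trans (nCk≡nC[n∸k] (m≤m+n i j)) (cong ((i + j) C_) (m+n∸m≡n i j))

[1+t]*-binomial : ∀ m → [1+t]* binomial m ≗ binomial (suc m)
[1+t]*-binomial m zero    = +-identityʳ (m C 0)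
[1+t]*-binomial m (suc i) = trans (+-comm (m C suc i) (m C i)) (nCk+nC[k+1]≡[n+1]C[k+1] m i)

binomial-unimodal : ∀ m k → 2 * suc k ≤ m → binomial m k ≤ binomial m (suc k)
binomial-unimodal (suc m) zero    _          = subst (1 ≤_) (sym (nC1≡n (suc m))) (s≤s z≤n)
binomial-unimodal (suc m) (suc k) 2[k+2]≤1+m = begin
  suc m C suc k                ≡⟨ nCk+nC[k+1]≡[n+1]C[k+1] m k ⟨
  m C k + m C suc k            ≤⟨ +-mono-≤ (binomial-unimodal m k 2[k+1]≤m) next ⟩
  m C suc k + m C suc (suc k)  ≡⟨ nCk+nC[k+1]≡[n+1]C[k+1] m (suc k) ⟩
  suc m C suc (suc k)          ∎
  where
  open ≤-Reasoning
  2[k+1]≤m : 2 * suc k ≤ m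
  2[k+1]≤m = ≤-pred (<-≤-trans (*-monoʳ-< 2 (n<1+n (suc k))) 2[k+2]≤1+m)
  next : m C suc k ≤ m C suc (suc k)
  next with 2 * suc (suc k) ≤? m
  ... | yes 2[k+2]≤m = binomial-unimodal m (suc k) 2[k+2]≤m
  ... | no  2[k+2]≰m =
    -- then m = (k + 1) + (k + 2)
    ≤-reflexive (subst (λ m → m C suc k ≡ m C suc (suc k)) m≡ (binomial-sym (suc k) (suc (suc k))))
    where
    m≡ : suc k + suc (suc k) ≡ m
    m≡ = suc-injective (trans (cong (λ x → suc (suc k + x)) (sym (+-identityʳ _)))
                              (≤-antisym 2[k+2]≤1+m (≰⇒> 2[k+2]≰m)))

t^-binomial-degree : ∀ u m j → u + m < j → (t^ u * binomial m) j ≡ 0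
t^-binomial-degree zero    m j       m<j             = k>n⇒nCk≡0 m<j
t^-binomial-degree (suc u) m (suc j) (s≤s u+m<j)     = t^-binomial-degree u m j u+m<j

t^-binomial-beyond : ∀ u m j → suc j ≡ 2 * suc u + m → (t^ u * binomial m) j ≡ 0
t^-binomial-beyond u m j 1+j≡ = t^-binomial-degree u m j
  (subst (u + m <_) (sym (suc-injective (trans 1+j≡ (cong (_+ m) (*-suc 2 u)))))
         (s≤s (+-monoˡ-≤ m (m≤n*m u 2))))

t^-binomial-sym : ∀ u m i j → i + j ≡ 2 * u + m → (t^ u * binomial m) i ≡ (t^ u * binomial m) j
t^-binomial-sym zero    m i       j       refl = binomial-sym i j
t^-binomial-sym (suc u) m zero    zero    ()
t^-binomial-sym (suc u) m zero    (suc j) eq   = sym (t^-binomial-beyond u m j eq)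
t^-binomial-sym (suc u) m (suc i) zero    eq   =
  t^-binomial-beyond u m i (trans (sym (+-identityʳ (suc i))) eq)
t^-binomial-sym (suc u) m (suc i) (suc j) eq   = t^-binomial-sym u m i j
  (suc-injective (suc-injective
    (trans (cong suc (sym (+-suc i j))) (trans eq (cong (_+ m) (*-suc 2 u))))))

t^-binomial-unimodal : ∀ u m i → 2 * suc i ≤ 2 * u + m →
                       (t^ u * binomial m) i ≤ (t^ u * binomial m) (suc i)
t^-binomial-unimodal zero    m i       le = binomial-unimodal m i le
t^-binomial-unimodal (suc u) m zero    le = z≤n
t^-binomial-unimodal (suc u) m (suc i) le = t^-binomial-unimodal u m i
  (≤-pred (≤-pred (subst₂ _≤_ (*-suc 2 (suc i)) (cong (_+ m) (*-suc 2 u)) le)))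

[1+t]*-t^-binomial : ∀ u m → [1+t]* t^ u * binomial m ≗ t^ u * binomial (suc m)
[1+t]*-t^-binomial zero    m i       = [1+t]*-binomial m i
[1+t]*-t^-binomial (suc u) m zero    = refl
[1+t]*-t^-binomial (suc u) m (suc i) = [1+t]*-t^-binomial u m i

-- γ-positivity

infixl 6 _⊕ᵍ_

-- Series are functions, so closure under pointwise equality is part of the definition.
data GammaPositive (n : ℕ) : Series → Set where
  basis : ∀ u m → 2 * u + m ≡ n → GammaPositive n (t^ u * binomial m)
  null  : GammaPositive n 𝟘
  _⊕ᵍ_  : GammaPositive n p → GammaPositive n q → GammaPositive n (p ⊕ q)
  resp  : p ≗ q → GammaPositive n p → GammaPositive n q

gp-cast : n ≡ m → GammaPositive n p → GammaPositive m p
gp-cast refl g = g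

[1+t]*-gp : GammaPositive n p → GammaPositive (suc n) ([1+t]* p)
[1+t]*-gp (basis u m refl) = resp (sym ∘ [1+t]*-t^-binomial u m) (basis u (suc m) (+-suc (2 * u) m))
[1+t]*-gp null             = resp (λ i → cong (_+_ 0) (t*-𝟘 i)) null
[1+t]*-gp (_⊕ᵍ_ {p} {q} g h) = resp (sym ∘ [1+t]*-⊕ p q) ([1+t]*-gp g ⊕ᵍ [1+t]*-gp h)
[1+t]*-gp (resp p≗q g)     = resp ([1+t]*-cong p≗q) ([1+t]*-gp g)

t*-gp : GammaPositive n p → GammaPositive (2 + n) (t* p)
t*-gp (basis u m refl) = basis (suc u) m (cong (_+ m) (*-suc 2 u))
t*-gp null             = resp t*-𝟘 null
t*-gp (_⊕ᵍ_ {p} {q} g h) = resp (sym ∘ t*-⊕ p q) (t*-gp g ⊕ᵍ t*-gp h)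
t*-gp (resp p≗q g)     = resp (t*-cong p≗q) (t*-gp g)

gp-degree : GammaPositive n p → ∀ j → n < j → p j ≡ 0
gp-degree (basis u m refl) j n<j =
  t^-binomial-degree u m j (≤-<-trans (+-monoˡ-≤ m (m≤n*m u 2)) n<j)
gp-degree null             j n<j = refl
gp-degree (g ⊕ᵍ h)         j n<j = cong₂ _+_ (gp-degree g j n<j) (gp-degree h j n<j)
gp-degree (resp p≗q g)     j n<j = trans (sym (p≗q j)) (gp-degree g j n<j)

gp-palindromic : GammaPositive n p → ∀ i → i ≤ n → p i ≡ p (n ∸ i)
gp-palindromic (basis u m refl) i i≤n = t^-binomial-sym u m i _ (m+[n∸m]≡n i≤n)
gp-palindromic null             i i≤n = refl
gp-palindromic (g ⊕ᵍ h)         i i≤n =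
  cong₂ _+_ (gp-palindromic g i i≤n) (gp-palindromic h i i≤n)
gp-palindromic (resp p≗q g)     i i≤n =
  trans (sym (p≗q i)) (trans (gp-palindromic g i i≤n) (p≗q _))

gp-unimodal-step : GammaPositive n p → ∀ i → 2 * suc i ≤ n → p i ≤ p (suc i)
gp-unimodal-step (basis u m refl) i le = t^-binomial-unimodal u m i le
gp-unimodal-step null             i le = z≤n
gp-unimodal-step (g ⊕ᵍ h)         i le =
  +-mono-≤ (gp-unimodal-step g i le) (gp-unimodal-step h i le)
gp-unimodal-step (resp p≗q g)     i le =
  subst₂ _≤_ (p≗q i) (p≗q (suc i)) (gp-unimodal-step g i le)

gp-unimodal : GammaPositive n p → ∀ i j → i ≤ j → j ≤ ⌊ n /2⌋ → p i ≤ p j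
gp-unimodal g i j       i≤j j≤n/2 with m≤n⇒m<n∨m≡n i≤j
gp-unimodal g i j       i≤j j≤n/2 | inj₂ refl = ≤-refl
gp-unimodal g i (suc j) i≤j j≤n/2 | inj₁ (s≤s i≤j') =
  ≤-trans (gp-unimodal g i j i≤j' (≤-trans (n≤1+n j) j≤n/2))
          (gp-unimodal-step g j (m≤⌊n/2⌋⇒2*m≤n _ j≤n/2))

gammaBasis : ℕ → ℕ → Series
gammaBasis n u = t^ u * binomial (n ∸ 2 * u)

gammaSum : ℕ → (ℕ → ℕ) → Series
gammaSum n γ i = ∑[ u < suc ⌊ n /2⌋ ] (γ u * gammaBasis n u i)

gp-expansion : GammaPositive n p → ∃ λ γ → p ≗ gammaSum n γ
gp-expansion {n} (basis u m refl) = (λ v → δ v u) , λ i → sym (begin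
  gammaSum n (λ v → δ v u) i
    ≡⟨ ∑-δ (suc ⌊ n /2⌋) (λ v → gammaBasis n v i) u (s≤s (2*m≤n⇒m≤⌊n/2⌋ u (m≤m+n _ m))) ⟩
  gammaBasis n u i
    ≡⟨ cong (λ k → (t^ u * binomial k) i) (m+n∸m≡n (2 * u) m) ⟩
  (t^ u * binomial m) i ∎)
  where open ≡-Reasoning
gp-expansion {n} null = (λ _ → 0) , λ i → sym (∑-zero (suc ⌊ n /2⌋) λ _ → refl)
gp-expansion {n} (g ⊕ᵍ h) with gp-expansion g | gp-expansion h
... | γ , p≗ | γ′ , q≗ = (λ u → γ u + γ′ u) , λ i → begin
  _ ≡⟨ cong₂ _+_ (p≗ i) (q≗ i) ⟩
  gammaSum n γ i + gammaSum n γ′ i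
    ≡⟨ ∑-distrib-+ (suc ⌊ n /2⌋) (λ u → γ u * gammaBasis n u i) (λ u → γ′ u * gammaBasis n u i) ⟨
  _ ≡⟨ ∑-cong (suc ⌊ n /2⌋) (λ u → *-distribʳ-+ (gammaBasis n u i) (γ u) (γ′ u)) ⟨
  gammaSum n (λ u → γ u + γ′ u) i ∎
  where open ≡-Reasoning
gp-expansion (resp p≗q g) with gp-expansion g
... | γ , p≗ = γ , λ i → trans (sym (p≗q i)) (p≗ i)

-- Newton coordinates

Seq : Set
Seq = ℕ → Series

infix 4 _≋_
_≋_ : Seq → Seq → Set
X ≋ Y = ∀ k → X k ≗ Y k

infixl 6 _⊕ˢ_
_⊕ˢ_ : Seq → Seq → Seq
(X ⊕ˢ Y) k = X k ⊕ Y k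

infixr 9 _^[_]_
_^[_]_ : {A : Set} → (A → A) → ℕ → A → A
F ^[ zero  ] x = x
F ^[ suc r ] x = F (F ^[ r ] x)

^-suc : ∀ {A : Set} (F : A → A) r x → F ^[ suc r ] x ≡ F ^[ r ] (F x)
^-suc F zero    x = refl
^-suc F (suc r) x = cong F (^-suc F r x)

^-+ : ∀ {A : Set} (F : A → A) b r x → F ^[ b + r ] x ≡ F ^[ b ] (F ^[ r ] x)
^-+ F zero    r x = refl
^-+ F (suc b) r x = cong F (^-+ F b r x)

Congruent : (Seq → Seq) → Set
Congruent F = ∀ {X Y} → X ≋ Y → F X ≋ F Y

private
  variable
    X Y : Seq

^-cong : ∀ {F} → Congruent F → ∀ r → Congruent (F ^[ r ]_)
^-cong F-cong zero    X≋Y = X≋Y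
^-cong F-cong (suc r) X≋Y = F-cong (^-cong F-cong r X≋Y)

≋-trans : X ≋ Y → ∀ {Z} → Y ≋ Z → X ≋ Z
≋-trans X≋Y Y≋Z k i = trans (X≋Y k i) (Y≋Z k i)

-- A sequence X stands for the function b ↦ Σₖ C(b,k) X k, whose value at b is valueAt X b.
-- In these coordinates advance is the shift b ↦ b + 1, and integrate is the summation
-- f ↦ (b ↦ f b + t Σ_{y<b} f y) (valueAt-integrate).
advance : Seq → Seq
advance X k = X k ⊕ X (suc k)

valueAt : Seq → ℕ → Series
valueAt X b = (advance ^[ b ] X) 0

integrate : Seq → Seq
integrate X zero    = X zero
integrate X (suc k) = X (suc k) ⊕ t* X k

constant : Series → Seq
constant c zero    = c
constant c (suc _) = 𝟘

retreat : Seq → Seq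
retreat X zero    = X zero
retreat X (suc k) = X (suc k) ⊕ X k

blockStep : Seq → Seq
blockStep X zero          = X 0
blockStep X (suc zero)    = X 1 ⊕ [1+t]* X 0
blockStep X (suc (suc j)) = X (suc (suc j)) ⊕ [1+t]* X (suc j) ⊕ t* X j

advance-cong : Congruent advance
advance-cong X≋Y k i = cong₂ _+_ (X≋Y k i) (X≋Y (suc k) i)

integrate-cong : Congruent integrate
integrate-cong X≋Y zero    i = X≋Y 0 i
integrate-cong X≋Y (suc k) i = cong₂ _+_ (X≋Y (suc k) i) (t*-cong (X≋Y k) i)

retreat-cong : Congruent retreat
retreat-cong X≋Y zero    i = X≋Y 0 i
retreat-cong X≋Y (suc k) i = cong₂ _+_ (X≋Y (suc k) i) (X≋Y k i)

advance^-constant : ∀ b c → advance ^[ b ] constant c ≋ constant c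
advance^-constant zero    c k i = refl
advance^-constant (suc b) c = ≋-trans (advance-cong (advance^-constant b c)) step
  where
  step : advance (constant c) ≋ constant c
  step zero    i = +-identityʳ (c i)
  step (suc k) i = refl

advance^-⊕-constant : ∀ b X c →
                      advance ^[ b ] (X ⊕ˢ constant c) ≋ advance ^[ b ] X ⊕ˢ constant c
advance^-⊕-constant zero    X c k i = refl
advance^-⊕-constant (suc b) X c =
  ≋-trans (advance-cong (advance^-⊕-constant b X c)) (step {advance ^[ b ] X})
  where
  step : ∀ {Z} → advance (Z ⊕ˢ constant c) ≋ advance Z ⊕ˢ constant c
  step {Z} zero    i =
    trans (interchange (Z 0 i) (c i) (Z 1 i) 0) (cong (Z 0 i + Z 1 i +_) (+-identityʳ (c i)))
  step {Z} (suc k) i = interchange (Z (suc k) i) 0 (Z (suc (suc k)) i) 0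

advance-integrate : ∀ X → advance (integrate X) ≋ integrate (advance X) ⊕ˢ constant (t* X 0)
advance-integrate X zero    i = sym (+-assoc (X 0 i) (X 1 i) ((t* X 0) i))
advance-integrate X (suc k) i = begin
  (X (suc k) i + (t* X k) i) + (X (suc (suc k)) i + (t* X (suc k)) i)
    ≡⟨ interchange (X (suc k) i) _ _ _ ⟩
  (X (suc k) i + X (suc (suc k)) i) + ((t* X k) i + (t* X (suc k)) i)
    ≡⟨ cong (X (suc k) i + X (suc (suc k)) i +_) (t*-⊕ (X k) (X (suc k)) i) ⟨
  (X (suc k) i + X (suc (suc k)) i) + (t* advance X k) i
    ≡⟨ +-identityʳ _ ⟨
  _ ∎
  where open ≡-Reasoning

valueAt-integrate : ∀ b X → valueAt (integrate X) b ≗ valueAt X b ⊕ t* ∑ˢ[ y < b ] valueAt X y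
valueAt-integrate zero    X i = sym (trans (cong (X 0 i +_) (sym (t*-𝟘 i))) (+-identityʳ (X 0 i)))
valueAt-integrate (suc b) X i = begin
  valueAt (integrate X) (suc b) i
    ≡⟨ cong (λ Z → Z 0 i) (^-suc advance b (integrate X)) ⟩
  (advance ^[ b ] advance (integrate X)) 0 i
    ≡⟨ ^-cong advance-cong b (advance-integrate X) 0 i ⟩
  (advance ^[ b ] (integrate (advance X) ⊕ˢ constant (t* X 0))) 0 i
    ≡⟨ advance^-⊕-constant b (integrate (advance X)) (t* X 0) 0 i ⟩
  valueAt (integrate (advance X)) b i + (t* X 0) i
    ≡⟨ cong (_+ (t* X 0) i) (valueAt-integrate b (advance X) i) ⟩
  valueAt (advance X) b i + (t* S) i + (t* X 0) i
    ≡⟨ regroup i ⟩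
  valueAt (advance X) b i + (t* (X 0 ⊕ S)) i
    ≡⟨ cong₂ _+_ (cong (λ Z → Z 0 i) (^-suc advance b X)) (t*-cong shifted i) ⟨
  valueAt X (suc b) i + (t* ∑ˢ[ y < suc b ] valueAt X y) i ∎
  where
  open ≡-Reasoning
  S = ∑ˢ[ y < b ] valueAt (advance X) y
  shifted : ∑ˢ[ y < suc b ] valueAt X y ≗ X 0 ⊕ S
  shifted j = cong (X 0 j +_) (∑-cong b λ y → cong (λ Z → Z 0 j) (^-suc advance y X))
  regroup : ∀ i → valueAt (advance X) b i + (t* S) i + (t* X 0) i ≡
                  valueAt (advance X) b i + (t* (X 0 ⊕ S)) i
  regroup zero    = +-identityʳ _
  regroup (suc i) = trans (+-assoc (valueAt (advance X) b (suc i)) (S i) (X 0 i))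
                          (cong (valueAt (advance X) b (suc i) +_) (+-comm (S i) (X 0 i)))

advance^-retreat^ : ∀ r X k → (advance ^[ r ] X) k ≗ (retreat ^[ r ] X) (k + r)
advance^-retreat^ zero    X k i = cong (λ k → X k i) (sym (+-identityʳ k))
advance^-retreat^ (suc r) X k i = begin
  (advance ^[ r ] X) k i + (advance ^[ r ] X) (suc k) i
    ≡⟨ cong₂ _+_ (advance^-retreat^ r X k i) (advance^-retreat^ r X (suc k) i) ⟩
  (retreat ^[ r ] X) (k + r) i + (retreat ^[ r ] X) (suc (k + r)) i
    ≡⟨ +-comm ((retreat ^[ r ] X) (k + r) i) _ ⟩
  retreat (retreat ^[ r ] X) (suc (k + r)) i
    ≡⟨ cong (λ k → retreat (retreat ^[ r ] X) k i) (+-suc k r) ⟨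
  retreat (retreat ^[ r ] X) (k + suc r) i ∎
  where open ≡-Reasoning

retreat-integrate : ∀ X → retreat (integrate X) ≋ integrate (retreat X)
retreat-integrate X zero          i = refl
retreat-integrate X (suc zero)    i = xy∙z≈xz∙y (X 1 i) _ _
retreat-integrate X (suc (suc k)) i =
  trans (interchange (X (suc (suc k)) i) ((t* X (suc k)) i) (X (suc k) i) ((t* X k) i))
        (cong (X (suc (suc k)) i + X (suc k) i +_) (sym (t*-⊕ (X (suc k)) (X k) i)))

retreat^-integrate : ∀ r X → retreat ^[ r ] integrate X ≋ integrate (retreat ^[ r ] X)
retreat^-integrate zero    X = λ k i → refl
retreat^-integrate (suc r) X =
  ≋-trans (retreat-cong (retreat^-integrate r X)) (retreat-integrate (retreat ^[ r ] X))

blockStep-retreat-integrate : ∀ X → blockStep X ≋ retreat (integrate X)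
blockStep-retreat-integrate X zero          i = refl
blockStep-retreat-integrate X (suc zero)    i = x∙yz≈xz∙y (X 1 i) (X 0 i) _
blockStep-retreat-integrate X (suc (suc j)) i =
  trans (cong (_+ (t* X j) i) (x∙yz≈xz∙y (X (suc (suc j)) i) (X (suc j) i) _))
        (+-assoc (X (suc (suc j)) i + (t* X (suc j)) i) (X (suc j) i) ((t* X j) i))

retreat^-integrate^ : ∀ r X → retreat ^[ r ] integrate ^[ r ] X ≋ blockStep ^[ r ] X
retreat^-integrate^ zero    X = λ k i → refl
retreat^-integrate^ (suc r) X = ≋-trans (retreat-cong (retreat^-integrate r (integrate ^[ r ] X)))
  (≋-trans (retreat-cong (integrate-cong (retreat^-integrate^ r X)))
           λ k i → sym (blockStep-retreat-integrate (blockStep ^[ r ] X) k i))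

-- The completions, counted by nonzero entries, of the last r coordinates of a block followed by
-- the blocks ρ, when the prefix sums may still grow by b; the next entry is 0 or 1 + y ≤ b.
latticeGF : ℕ → ℕ → List ℕ → Series
latticeGF zero    b []      = 𝟙
latticeGF zero    b (r ∷ ρ) = latticeGF r (b + r) ρ
latticeGF (suc r) b ρ       = latticeGF r b ρ ⊕ t* ∑ˢ[ y < b ] latticeGF r (b ∸ suc y) ρ

-- Newton coordinates of b ↦ latticeGF 0 b ρ: a block of size r integrates r times and shifts b
-- by r, which advance^-retreat^ and retreat^-integrate^ turn into r block steps and an index shift.
newtonSeq : List ℕ → Seq
newtonSeq []      = constant 𝟙
newtonSeq (r ∷ ρ) k = (blockStep ^[ r ] newtonSeq ρ) (k + r)

latticeGF-newton : ∀ r b ρ → latticeGF r b ρ ≗ valueAt (integrate ^[ r ] newtonSeq ρ) b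
latticeGF-newton zero b [] i = sym (advance^-constant b 𝟙 0 i)
latticeGF-newton zero b (r ∷ ρ) i = begin
  latticeGF r (b + r) ρ i
    ≡⟨ latticeGF-newton r (b + r) ρ i ⟩
  (advance ^[ b + r ] integrate ^[ r ] newtonSeq ρ) 0 i
    ≡⟨ cong (λ Z → Z 0 i) (^-+ advance b r _) ⟩
  (advance ^[ b ] advance ^[ r ] integrate ^[ r ] newtonSeq ρ) 0 i
    ≡⟨ ^-cong advance-cong b block 0 i ⟩
  valueAt (newtonSeq (r ∷ ρ)) b i ∎
  where
  open ≡-Reasoning
  block : advance ^[ r ] integrate ^[ r ] newtonSeq ρ ≋ newtonSeq (r ∷ ρ)
  block k j = trans (advance^-retreat^ r _ k j) (retreat^-integrate^ r (newtonSeq ρ) (k + r) j)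
latticeGF-newton (suc r) b ρ i = begin
  latticeGF r b ρ i + (t* ∑ˢ[ y < b ] latticeGF r (b ∸ suc y) ρ) i
    ≡⟨ cong₂ _+_ (latticeGF-newton r b ρ i)
                 (t*-cong (λ j → ∑-cong b λ y → latticeGF-newton r (b ∸ suc y) ρ j) i) ⟩
  V b i + (t* ∑ˢ[ y < b ] V (b ∸ suc y)) i
    ≡⟨ cong (V b i +_) (t*-cong (λ j → ∑-reverse b λ y → V y j) i) ⟩
  V b i + (t* ∑ˢ[ y < b ] V y) i
    ≡⟨ valueAt-integrate b (integrate ^[ r ] newtonSeq ρ) i ⟨
  valueAt (integrate ^[ suc r ] newtonSeq ρ) b i ∎
  where
  open ≡-Reasoning
  V = valueAt (integrate ^[ r ] newtonSeq ρ)

-- The factors 1, 1 + t and t raise the centres c + j, c + j - 1, c + j - 2 of the three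
-- summands of blockStep X j to c + j.
blockStep-gp : ∀ c {X} → (∀ j → GammaPositive (c + j) (X j)) →
               ∀ j → GammaPositive (c + j) (blockStep X j)
blockStep-gp c g zero          = g 0
blockStep-gp c g (suc zero)    = g 1 ⊕ᵍ gp-cast (sym (+-suc c 0)) ([1+t]*-gp (g 0))
blockStep-gp c g (suc (suc j)) =
  g (suc (suc j)) ⊕ᵍ gp-cast (sym (+-suc c (suc j))) ([1+t]*-gp (g (suc j)))
                  ⊕ᵍ gp-cast (sym (trans (+-suc c (suc j)) (cong suc (+-suc c j)))) (t*-gp (g j))

blockStep^-gp : ∀ c r {X} → (∀ j → GammaPositive (c + j) (X j)) →
                ∀ j → GammaPositive (c + j) ((blockStep ^[ r ] X) j)
blockStep^-gp c zero    g = g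
blockStep^-gp c (suc r) g = blockStep-gp c (blockStep^-gp c r g)

newtonSeq-gp : ∀ ρ k → GammaPositive (sum ρ + k) (newtonSeq ρ k)
newtonSeq-gp []      zero    = resp binomial-zero (basis 0 0 refl)
newtonSeq-gp []      (suc k) = null
newtonSeq-gp (r ∷ ρ) k       =
  gp-cast (rearrange r (sum ρ) k) (blockStep^-gp (sum ρ) r (newtonSeq-gp ρ) (k + r))
  where
  rearrange : ∀ r s k → s + (k + r) ≡ r + s + k
  rearrange = solve-∀

-- Counting lattice points

indicator : ∀ {A : Set} → Dec A → ℕ
indicator a? = if does a? then 1 else 0

private
  variable
    A B : Set

indicator-≟ : ∀ m n → indicator (m ≟ n) ≡ δ m n
indicator-≟ zero    zero    = refl
indicator-≟ zero    (suc n) = refl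
indicator-≟ (suc m) zero    = refl
indicator-≟ (suc m) (suc n) = indicator-≟ m n

indicator-all? : ∀ {P : A → Set} (P? : Decidable P) xs →
                 indicator (all? P? xs) ≡ product (map (indicator ∘ P?) xs)
indicator-all? P? []       = refl
indicator-all? P? (x ∷ xs) with does (P? x)
... | true  = trans (indicator-all? P? xs) (sym (+-identityʳ _))
... | false = refl

sum-map-zero : ∀ {w : A → ℕ} xs → (∀ x → w x ≡ 0) → sum (map w xs) ≡ 0
sum-map-zero []       w≗0 = refl
sum-map-zero (x ∷ xs) w≗0 = cong₂ _+_ (w≗0 x) (sum-map-zero xs w≗0)

sum-map-concatMap : ∀ (w : B → ℕ) (f : A → List B) xs →
                    sum (map w (concatMap f xs)) ≡ sum (map (λ x → sum (map w (f x))) xs)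
sum-map-concatMap w f []       = refl
sum-map-concatMap w f (x ∷ xs) = begin
  sum (map w (f x ++ concatMap f xs))
    ≡⟨ cong sum (map-++ w (f x) (concatMap f xs)) ⟩
  sum (map w (f x) ++ map w (concatMap f xs))
    ≡⟨ sum-++ (map w (f x)) _ ⟩
  sum (map w (f x)) + sum (map w (concatMap f xs))
    ≡⟨ cong (sum (map w (f x)) +_) (sum-map-concatMap w f xs) ⟩
  _ ∎
  where open ≡-Reasoning

sum-map-applyUpTo : ∀ (w : A → ℕ) (f : ℕ → A) n →
                    sum (map w (applyUpTo f n)) ≡ ∑[ x < n ] w (f x)
sum-map-applyUpTo w f zero    = refl
sum-map-applyUpTo w f (suc n) = cong (w (f 0) +_) (sum-map-applyUpTo w (f ∘ suc) n)

sum-map-filter : ∀ {P : A → Set} (P? : Decidable P) (w : A → ℕ) xs →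
                 sum (map w (filter P? xs)) ≡ sum (map (λ x → indicator (P? x) * w x) xs)
sum-map-filter P? w []       = refl
sum-map-filter P? w (x ∷ xs) with does (P? x)
... | true  = cong₂ _+_ (sym (+-identityʳ (w x))) (sum-map-filter P? w xs)
... | false = sum-map-filter P? w xs

length-filter : ∀ {P : A → Set} (P? : Decidable P) xs →
                length (filter P? xs) ≡ sum (map (indicator ∘ P?) xs)
length-filter P? []       = refl
length-filter P? (x ∷ xs) with does (P? x)
... | true  = cong suc (length-filter P? xs)
... | false = length-filter P? xs

boxGF : (m N : ℕ) → (Vec ℕ m → ℕ) → Series
boxGF m N w i = sum (map (λ a → w a * δ (nonzeros a) i) (boxVecs m N))

boxGF-cong : ∀ m N {w w′ : Vec ℕ m → ℕ} → (∀ a → w a ≡ w′ a) → boxGF m N w ≗ boxGF m N w′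
boxGF-cong m N w≗w′ i =
  cong sum (map-cong (λ a → cong (_* δ (nonzeros a) i) (w≗w′ a)) (boxVecs m N))

boxGF-null : ∀ m N {w : Vec ℕ m → ℕ} → (∀ a → w a ≡ 0) → boxGF m N w ≗ 𝟘
boxGF-null m N w≗0 i = sum-map-zero (boxVecs m N) (λ a → cong (_* δ (nonzeros a) i) (w≗0 a))

boxGF-suc : ∀ m N (w : Vec ℕ (suc m) → ℕ) →
            boxGF (suc m) N w ≗
            boxGF m N (w ∘ (0 ∷ᵥ_)) ⊕ t* ∑ˢ[ y < N ] boxGF m N (w ∘ (suc y ∷ᵥ_))
boxGF-suc m N w i = begin
  boxGF (suc m) N w i
    ≡⟨ sum-map-concatMap term (λ x → map (x ∷ᵥ_) (boxVecs m N)) (upTo (suc N)) ⟩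
  sum (map (λ x → sum (map term (map (x ∷ᵥ_) (boxVecs m N)))) (upTo (suc N)))
    ≡⟨ sum-map-applyUpTo _ id (suc N) ⟩
  ∑[ x < suc N ] sum (map term (map (x ∷ᵥ_) (boxVecs m N)))
    ≡⟨ ∑-cong (suc N) (λ x → cong sum (sym (map-∘ {g = term} {f = x ∷ᵥ_} (boxVecs m N)))) ⟩
  ∑[ x < suc N ] sum (map (term ∘ (x ∷ᵥ_)) (boxVecs m N))
    ≡⟨ cong (boxGF m N (w ∘ (0 ∷ᵥ_)) i +_) (nonzero i) ⟩
  boxGF m N (w ∘ (0 ∷ᵥ_)) i + (t* ∑ˢ[ y < N ] boxGF m N (w ∘ (suc y ∷ᵥ_))) i ∎
  where
  open ≡-Reasoning
  term : Vec ℕ (suc m) → ℕ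
  term a = w a * δ (nonzeros a) i
  nonzero : ∀ i →
            ∑[ y < N ] sum (map (λ a → w (suc y ∷ᵥ a) * δ (nonzeros (suc y ∷ᵥ a)) i) (boxVecs m N)) ≡
            (t* ∑ˢ[ y < N ] boxGF m N (w ∘ (suc y ∷ᵥ_))) i
  nonzero zero    = ∑-zero N λ y → sum-map-zero (boxVecs m N) λ a → *-zeroʳ (w (suc y ∷ᵥ a))
  nonzero (suc i) = refl

-- A pair (s , c) is the constraint that the first s entries sum to at most c.
withinBounds : List (ℕ × ℕ) → List ℕ → ℕ
withinBounds []             l = 1
withinBounds ((s , c) ∷ cs) l = indicator (sum (take s l) ≤? c) * withinBounds cs l

-- The constraints left when r coordinates of the current block remain with slack b; each later
-- block of size r′ adds r′ to both the length and the bound.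
blockBounds : ℕ → ℕ → List ℕ → List (ℕ × ℕ)
blockBounds r b []       = (r , b) ∷ []
blockBounds r b (r′ ∷ ρ) = (r , b) ∷ blockBounds (r + r′) (b + r′) ρ

blockIndicator : ℕ → ℕ → List ℕ → Vec ℕ m → ℕ
blockIndicator r b ρ a = withinBounds (blockBounds r b ρ) (toList a)

indicator-⇔ : ∀ {P Q : Set} → (P → Q) → (Q → P) → (p? : Dec P) (q? : Dec Q) →
              indicator p? ≡ indicator q?
indicator-⇔ P→Q Q→P (yes p) (yes q) = refl
indicator-⇔ P→Q Q→P (yes p) (no ¬q) = ⊥-elim (¬q (P→Q p))
indicator-⇔ P→Q Q→P (no ¬p) (yes q) = ⊥-elim (¬p (Q→P q))
indicator-⇔ P→Q Q→P (no ¬p) (no ¬q) = refl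

indicator-no : ∀ {P : Set} → ¬ P → (p? : Dec P) → indicator p? ≡ 0
indicator-no ¬p (yes p) = ⊥-elim (¬p p)
indicator-no ¬p (no _)  = refl

indicator-+≤ : ∀ {x c} s → x ≤ c → indicator (x + s ≤? c) ≡ indicator (s ≤? c ∸ x)
indicator-+≤ {x} {c} s x≤c = indicator-⇔
  (λ x+s≤c → m+n≤o⇒m≤o∸n s (subst (_≤ c) (+-comm x s) x+s≤c))
  (λ s≤c∸x → subst (x + s ≤_) (m+[n∸m]≡n x≤c) (+-monoʳ-≤ x s≤c∸x))
  (x + s ≤? c) (s ≤? c ∸ x)

indicator-+≤-overflow : ∀ {x c} s → c < x → indicator (x + s ≤? c) ≡ 0
indicator-+≤-overflow {x} {c} s c<x =
  indicator-no (λ x+s≤c → <⇒≱ c<x (m+n≤o⇒m≤o x x+s≤c)) (x + s ≤? c)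

withinBounds-peel : ∀ ρ r {b x} → x ≤ b → ∀ l →
                    withinBounds (blockBounds (suc r) b ρ) (x ∷ l) ≡
                    withinBounds (blockBounds r (b ∸ x) ρ) l
withinBounds-peel []       r x≤b l = cong (_* 1) (indicator-+≤ _ x≤b)
withinBounds-peel (r′ ∷ ρ) r {b} {x} x≤b l = cong₂ _*_ (indicator-+≤ _ x≤b)
  (trans (withinBounds-peel ρ (r + r′) (≤-trans x≤b (m≤m+n b r′)) l)
         (cong (λ c → withinBounds (blockBounds (r + r′) c ρ) l) (+-∸-comm r′ x≤b)))

withinBounds-overflow : ∀ ρ r {b x} → b < x → ∀ l →
                        withinBounds (blockBounds (suc r) b ρ) (x ∷ l) ≡ 0
withinBounds-overflow []       r b<x l = cong (_* 1) (indicator-+≤-overflow _ b<x)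
withinBounds-overflow (r′ ∷ ρ) r {b} {x} b<x l =
  cong (_* withinBounds (blockBounds (suc r + r′) (b + r′) ρ) (x ∷ l)) (indicator-+≤-overflow _ b<x)

boxGF-blockBounds : ∀ r b ρ {N} → b + sum ρ ≤ N →
                    boxGF (r + sum ρ) N (blockIndicator r b ρ) ≗ latticeGF r b ρ
boxGF-blockBounds zero    b []       _  zero    = refl
boxGF-blockBounds zero    b []       _  (suc i) = refl
boxGF-blockBounds zero    b (r′ ∷ ρ) {N} le i =
  trans (boxGF-cong (r′ + sum ρ) N (λ a → +-identityʳ (blockIndicator r′ (b + r′) ρ a)) i)
        (boxGF-blockBounds r′ (b + r′) ρ (subst (_≤ N) (sym (+-assoc b r′ (sum ρ))) le) i)
boxGF-blockBounds (suc r) b ρ {N} le i = begin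
  boxGF (suc (r + sum ρ)) N W i
    ≡⟨ boxGF-suc _ N W i ⟩
  boxGF d N (W ∘ (0 ∷ᵥ_)) i + (t* ∑ˢ[ y < N ] boxGF d N (W ∘ (suc y ∷ᵥ_))) i
    ≡⟨ cong₂ _+_ (trans (boxGF-cong d N (λ a → withinBounds-peel ρ r z≤n (toList a)) i)
                        (boxGF-blockBounds r b ρ le i))
                 (t*-cong positive i) ⟩
  latticeGF (suc r) b ρ i ∎
  where
  open ≡-Reasoning
  d = r + sum ρ
  W = blockIndicator (suc r) b ρ
  bound : ∀ y → b ∸ suc y + sum ρ ≤ N
  bound y = ≤-trans (+-monoˡ-≤ (sum ρ) (m∸n≤m b (suc y))) le
  positive : ∑ˢ[ y < N ] boxGF d N (W ∘ (suc y ∷ᵥ_)) ≗ ∑ˢ[ y < b ] latticeGF r (b ∸ suc y) ρ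
  positive j = begin
    ∑[ y < N ] boxGF d N (W ∘ (suc y ∷ᵥ_)) j
      ≡⟨ ∑-extend N _ (≤-trans (m≤m+n b (sum ρ)) le) (λ y b≤y →
           boxGF-null d N (λ a → withinBounds-overflow ρ r (s≤s b≤y) (toList a)) j) ⟩
    ∑[ y < b ] boxGF d N (W ∘ (suc y ∷ᵥ_)) j
      ≡⟨ ∑-cong-< b (λ y y<b →
           trans (boxGF-cong d N (λ a → withinBounds-peel ρ r y<b (toList a)) j)
                 (boxGF-blockBounds r (b ∸ suc y) ρ (bound y) j)) ⟩
    ∑[ y < b ] latticeGF r (b ∸ suc y) ρ j ∎

withinBounds-diagonal : ∀ a ρ l → withinBounds (blockBounds a a ρ) l ≡
                        product (map (λ s → indicator (sum (take s l) ≤? s)) (a ∷ partialSumsFrom a ρ))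
withinBounds-diagonal a []       l = refl
withinBounds-diagonal a (r′ ∷ ρ) l =
  cong (indicator (sum (take a l) ≤? a) *_) (withinBounds-diagonal (a + r′) ρ l)

hcoeff-boxGF : ∀ n r ρ → hcoeff n (r ∷ ρ) ≗ boxGF n n (blockIndicator r r ρ)
hcoeff-boxGF n r ρ i = begin
  length (filter (λ a → nonzeros a ≟ i) (filter (inQ? (r ∷ ρ)) (boxVecs n n)))
    ≡⟨ length-filter (λ a → nonzeros a ≟ i) (filter (inQ? (r ∷ ρ)) (boxVecs n n)) ⟩
  sum (map (λ a → indicator (nonzeros a ≟ i)) (filter (inQ? (r ∷ ρ)) (boxVecs n n)))
    ≡⟨ sum-map-filter (inQ? (r ∷ ρ)) _ (boxVecs n n) ⟩
  sum (map (λ a → indicator (inQ? (r ∷ ρ) a) * indicator (nonzeros a ≟ i)) (boxVecs n n))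
    ≡⟨ cong sum (map-cong (λ a → cong₂ _*_ (constraints a) (indicator-≟ (nonzeros a) i)) (boxVecs n n)) ⟩
  boxGF n n (blockIndicator r r ρ) i ∎
  where
  open ≡-Reasoning
  constraints : ∀ a → indicator (inQ? (r ∷ ρ) a) ≡ withinBounds (blockBounds r r ρ) (toList a)
  constraints a =
    trans (indicator-all? _ (partialSums (r ∷ ρ))) (sym (withinBounds-diagonal r ρ (toList a)))

hcoeff-newton : ∀ r ρ → hcoeff (r + sum ρ) (r ∷ ρ) ≗ newtonSeq (r ∷ ρ) 0
hcoeff-newton r ρ i = begin
  hcoeff (r + sum ρ) (r ∷ ρ) i                   ≡⟨ hcoeff-boxGF (r + sum ρ) r ρ i ⟩
  boxGF (r + sum ρ) _ (blockIndicator r r ρ) i   ≡⟨ boxGF-blockBounds r r ρ ≤-refl i ⟩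
  latticeGF 0 0 (r ∷ ρ) i                        ≡⟨ latticeGF-newton 0 0 (r ∷ ρ) i ⟩
  newtonSeq (r ∷ ρ) 0 i                          ∎
  where open ≡-Reasoning

-- Coefficient lists

coeff-+ₚ : ∀ p q j → coeff (p +ₚ q) j ≡ coeff p j + coeff q j
coeff-+ₚ []      q       j       = refl
coeff-+ₚ (c ∷ p) []      j       = sym (+-identityʳ _)
coeff-+ₚ (c ∷ p) (d ∷ q) zero    = refl
coeff-+ₚ (c ∷ p) (d ∷ q) (suc j) = coeff-+ₚ p q j

coeff-·ₚ : ∀ c p j → coeff (c ·ₚ p) j ≡ c * coeff p j
coeff-·ₚ c []      j       = sym (*-zeroʳ c)
coeff-·ₚ c (d ∷ p) zero    = refl
coeff-·ₚ c (d ∷ p) (suc j) = coeff-·ₚ c p j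

coeff-0∷ : ∀ p → coeff (0 ∷ p) ≗ t* coeff p
coeff-0∷ p zero    = refl
coeff-0∷ p (suc j) = refl

coeff-0∷-*ₚ : ∀ p q → coeff ((0 ∷ p) *ₚ q) ≗ t* coeff (p *ₚ q)
coeff-0∷-*ₚ p q j = begin
  coeff ((0 ·ₚ q) +ₚ (0 ∷ (p *ₚ q))) j      ≡⟨ coeff-+ₚ (0 ·ₚ q) _ j ⟩
  coeff (0 ·ₚ q) j + coeff (0 ∷ (p *ₚ q)) j ≡⟨ cong (_+ coeff (0 ∷ (p *ₚ q)) j) (coeff-·ₚ 0 q j) ⟩
  coeff (0 ∷ (p *ₚ q)) j                    ≡⟨ coeff-0∷ (p *ₚ q) j ⟩
  (t* coeff (p *ₚ q)) j                     ∎
  where open ≡-Reasoning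

coeff-sumₚ-upTo : ∀ (f : ℕ → Poly) n j →
                  coeff (sumₚ (map f (upTo n))) j ≡ ∑[ x < n ] coeff (f x) j
coeff-sumₚ-upTo f n j = trans (coeff-sumₚ (upTo n)) (sum-map-applyUpTo (λ x → coeff (f x) j) id n)
  where
  coeff-sumₚ : ∀ xs → coeff (sumₚ (map f xs)) j ≡ sum (map (λ x → coeff (f x) j) xs)
  coeff-sumₚ []       = refl
  coeff-sumₚ (x ∷ xs) = trans (coeff-+ₚ (f x) _ j) (cong (coeff (f x) j +_) (coeff-sumₚ xs))

coeff-tPow : ∀ i → coeff (tPow i) ≗ δ i
coeff-tPow zero    zero    = refl
coeff-tPow zero    (suc j) = refl
coeff-tPow (suc i) zero    = refl
coeff-tPow (suc i) (suc j) = coeff-tPow i j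

coeff-oneₚ*ₚ : ∀ q → coeff (oneₚ *ₚ q) ≗ coeff q
coeff-oneₚ*ₚ q j = begin
  coeff ((1 ·ₚ q) +ₚ (0 ∷ [])) j      ≡⟨ coeff-+ₚ (1 ·ₚ q) (0 ∷ []) j ⟩
  coeff (1 ·ₚ q) j + coeff (0 ∷ []) j
    ≡⟨ cong₂ _+_ (trans (coeff-·ₚ 1 q j) (*-identityˡ _)) (coeff-0∷ [] j) ⟩
  coeff q j + (t* 𝟘) j                ≡⟨ cong (coeff q j +_) (t*-𝟘 j) ⟨
  coeff q j + 0                       ≡⟨ +-identityʳ _ ⟩
  coeff q j                           ∎
  where open ≡-Reasoning

coeff-onePlusT^ : ∀ m → coeff (onePlusT ^ₚ m) ≗ binomial m
coeff-onePlusT^ zero    j = trans (coeff-tPow 0 j) (sym (binomial-zero j))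
coeff-onePlusT^ (suc m) j = begin
  coeff ((1 ·ₚ Q) +ₚ (0 ∷ (oneₚ *ₚ Q))) j
    ≡⟨ coeff-+ₚ (1 ·ₚ Q) _ j ⟩
  coeff (1 ·ₚ Q) j + coeff (0 ∷ (oneₚ *ₚ Q)) j
    ≡⟨ cong₂ _+_ (trans (coeff-·ₚ 1 Q j) (*-identityˡ _))
                 (trans (coeff-0∷ _ j) (t*-cong (coeff-oneₚ*ₚ Q) j)) ⟩
  ([1+t]* coeff Q) j     ≡⟨ [1+t]*-cong (coeff-onePlusT^ m) j ⟩
  ([1+t]* binomial m) j  ≡⟨ [1+t]*-binomial m j ⟩
  binomial (suc m) j     ∎
  where
  open ≡-Reasoning
  Q = onePlusT ^ₚ m

coeff-tPow*ₚonePlusT^ : ∀ u m → coeff (tPow u *ₚ (onePlusT ^ₚ m)) ≗ t^ u * binomial m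
coeff-tPow*ₚonePlusT^ zero    m j = trans (coeff-oneₚ*ₚ (onePlusT ^ₚ m) j) (coeff-onePlusT^ m j)
coeff-tPow*ₚonePlusT^ (suc u) m j =
  trans (coeff-0∷-*ₚ (tPow u) _ j) (t*-cong (coeff-tPow*ₚonePlusT^ u m) j)

coeff-gammaExpansion : ∀ n γ → coeff (gammaExpansion n γ) ≗ gammaSum n γ
coeff-gammaExpansion n γ j =
  trans (coeff-sumₚ-upTo (λ u → γ u ·ₚ term u) (suc ⌊ n /2⌋) j)
        (∑-cong (suc ⌊ n /2⌋) λ u →
           trans (coeff-·ₚ (γ u) (term u) j) (cong (γ u *_) (coeff-tPow*ₚonePlusT^ u (n ∸ 2 * u) j)))
  where
  term : ℕ → Poly
  term u = tPow u *ₚ (onePlusT ^ₚ (n ∸ 2 * u))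

coeff-hPoly : ∀ n σ → (∀ j → n < j → hcoeff n σ j ≡ 0) → coeff (hPoly n σ) ≗ hcoeff n σ
coeff-hPoly n σ vanishes j =
  trans (coeff-sumₚ-upTo (λ i → hcoeff n σ i ·ₚ tPow i) (suc n) j) (trans (∑-cong (suc n) terms) select)
  where
  terms : ∀ i → coeff (hcoeff n σ i ·ₚ tPow i) j ≡ δ i j * hcoeff n σ i
  terms i = trans (coeff-·ₚ (hcoeff n σ i) (tPow i) j)
                  (trans (cong (hcoeff n σ i *_) (coeff-tPow i j)) (*-comm (hcoeff n σ i) (δ i j)))
  select : ∑[ i < suc n ] (δ i j * hcoeff n σ i) ≡ hcoeff n σ j
  select with j ≤? n
  ... | yes j≤n = ∑-δ (suc n) (hcoeff n σ) j (s≤s j≤n)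
  ... | no  j≰n =
    trans (∑-δ-beyond (suc n) (hcoeff n σ) j (≰⇒> j≰n)) (sym (vanishes j (≰⇒> j≰n)))

hPoly-gammaExpansion : ∀ n σ → GammaPositive n (hcoeff n σ) →
                       ∃ λ γ → ∀ j → coeff (hPoly n σ) j ≡ coeff (gammaExpansion n γ) j
hPoly-gammaExpansion n σ h with gp-expansion h
... | γ , h≗γ = γ , λ j → begin
  coeff (hPoly n σ) j           ≡⟨ coeff-hPoly n σ (gp-degree h) j ⟩
  hcoeff n σ j                  ≡⟨ h≗γ j ⟩
  gammaSum n γ j                ≡⟨ coeff-gammaExpansion n γ j ⟨
  coeff (gammaExpansion n γ) j  ∎
  where open ≡-Reasoning

hcoeff-gammaPositive : ∀ r ρ → GammaPositive (r + sum ρ) (hcoeff (r + sum ρ) (r ∷ ρ))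
hcoeff-gammaPositive r ρ =
  resp (sym ∘ hcoeff-newton r ρ) (gp-cast (+-identityʳ _) (newtonSeq-gp (r ∷ ρ) 0))

theorem1p2 : (n : ℕ) → 0 < n → (σ : List ℕ) → IsComposition n σ →
    -- γ-positivity: h(σ,t) = Σ_{i ≤ ⌊n/2⌋} γ_i tⁱ (1+t)^{n-2i} with γ_i ∈ ℕ
    (∃ λ (γ : ℕ → ℕ) →
      ∀ j → coeff (hPoly n σ) j ≡ coeff (gammaExpansion n γ) j)
    -- palindromic
    × (∀ i → i ≤ n → hcoeff n σ i ≡ hcoeff n σ (n ∸ i))
    -- unimodal: h_0 ≤ h_1 ≤ ⋯ ≤ h_{⌊n/2⌋}
    × (∀ i j → i ≤ j → j ≤ ⌊ n /2⌋ → hcoeff n σ i ≤ hcoeff n σ j)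
theorem1p2 .0 () [] (_ , refl)
theorem1p2 .(r + sum ρ) _ (r ∷ ρ) (_ , refl) =
  hPoly-gammaExpansion _ (r ∷ ρ) h , gp-palindromic h , gp-unimodal h
  where h = hcoeff-gammaPositive r ρ
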